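{- Let $\delta$ be an even positive integer. Define the sequence $(U_m)_{m\ge 0}$ by $U_0=1$, $U_1=\delta^2-1$, $U_{m+2}=2(\delta^2-1)U_{m+1}-U_m$ for $m\ge 0$, and for each $m$ put $$n_m=\frac{2(\delta+1)U_m-\delta(\delta+2)}{\delta^2-2}.$$ For each $m$ consider the quadratic polynomial $$f_m(t)=t^2-(\delta n_m+\delta+2)\,t+\frac{n_m^2+1}{2}.$$ Then for every $m\ge 1$, the polynomials $f_m$ and $f_{m+1}$ (corresponding to two consecutive terms $U_m,U_{m+1}$ of the sequence) have a common root.
   Context: The $U_m$ are the solutions of the Pell equation $U^2-(\delta^2-2)V^2=1$. Each $n_m$ is an odd integer, and the roots of $f_m$ are divisors $d_1,d_2$ of $(n_m^2+1)/2$ with $d_1+d_2=\delta n_m+\delta+2$ and $d_1d_2=(n_m^2+1)/2$; thus the statement says that the integers $(n_m^2+1)/2$ and $(n_{m+1}^2+1)/2$ share such a divisor. -}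

module Defs where

open import Data.Nat using (ℕ; zero; suc)
open import Data.Integer using (ℤ; +_; _+_; _-_; _*_)
open import Data.Integer.DivMod using (_/ℕ_)

-- Integer division by a natural number, with the (irrelevant) convention a ÷ 0 = 0.
-- In the theorem it is only used with divisors δ²-2 ≥ 2 and 2, where the
-- division is exact (cf. context: n_m is an odd integer).
_÷_ : ℤ → ℕ → ℤ
a ÷ zero    = + 0
a ÷ (suc k) = a /ℕ (suc k)

U : ℕ → ℕ → ℤ
U δ zero          = + 1
U δ (suc zero)    = (+ δ * + δ) - + 1
U δ (suc (suc m)) = (+ 2 * ((+ δ * + δ) - + 1)) * U δ (suc m) - U δ m

-- δ² - 2 as a natural number (used only for δ ≥ 2)
D : ℕ → ℕ
D δ = Data.Nat._∸_ (Data.Nat._*_ δ δ) 2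

nSeq : ℕ → ℕ → ℤ
nSeq δ m = ((+ 2 * (+ δ + + 1)) * U δ m - + δ * (+ δ + + 2)) ÷ D δ

f : ℕ → ℕ → ℤ → ℤ
f δ m t = t * t - (+ δ * nSeq δ m + + δ + + 2) * t + ((nSeq δ m * nSeq δ m + + 1) ÷ 2)

module Submission where

-- Write d = δ and U_m = 1 + (d² - 2)·W_m, where W is the
-- integer sequence W_0 = 0, W_1 = 1, W_{m+2} = 2(d²-1)W_{m+1} - W_m + 2.
-- Then n_m = 2(d+1)W_m - 1, so f_m is a quadratic polynomial whose coefficients
-- are polynomials in x = W_m (the divisions in n_m and in (n_m²+1)/2 are exact).
--
-- 1. Consecutive terms (x, y) = (W_m, W_{m+1}) lie on the conic
--      x² + y² - 2(d²-1)xy - 2x - 2y + 1 = 0,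
--    which is invariant under the Vieta jump (x, y) ↦ (y, 2(d²-1)y - x + 2)
--    generating W; it is symmetric in x and y.
-- 2. x + y ≡ 1 (mod d), i.e. x + y = 1 + dz for some integer z.
-- 3. The polynomial identity  d²·f_x(1 + (d+1)z) = (d+1)²·conic(x, 1 + dz - x)
--    shows that t = 1 + (d+1)z is a root of f_m; exchanging x and y (the conic
--    and the relation x + y = 1 + dz are symmetric) it is also a root of f_{m+1}.  The argument works for every m ≥ 0;
-- evenness of δ is only used to guarantee δ ≥ 2.

open import Defs
open import Data.Nat using (ℕ; suc; _≤_; _<_)
open import Data.Nat.Divisibility using (_∣_)
open import Data.Integer using (ℤ; +_)
open import Data.Product using (∃-syntax; _×_)
open import Relation.Binary.PropositionalEquality using (_≡_)

import Data.Nat as ℕ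
import Data.Nat.Properties as ℕ
open import Data.Nat.Divisibility using (∣⇒≤)
open import Data.Integer using (_+_; _-_; _*_; _⊖_; 0ℤ; NonZero) renaming (suc to sucℤ; _≤_ to _≤ℤ_; _<_ to _<ℤ_)
open import Data.Integer.Properties
  using (≤-antisym; ≤-trans; ≤-reflexive; *-cancelʳ-≤-pos; *-cancelʳ-<-nonNeg; i<j⇒i≤pred[j]; pred-suc;
         *-cancelˡ-≡; *-zeroʳ; *-assoc; +-comm; ⊖-≥; m-n≡m⊖n; pos-*)
open import Data.Integer.DivMod using (_/ℕ_; [n/ℕd]*d≤n; n<s[n/ℕd]*d)
open import Data.Integer.Tactic.RingSolver using (solve-∀)
open import Data.Product using (_,_; proj₁)
open import Relation.Binary.PropositionalEquality using (sym; trans; cong; cong₂; module ≡-Reasoning)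

open ≡-Reasoning

-- The polynomial identities below are proved by the ring solver, which does
-- not unfold definitions; each is therefore stated with the relevant
-- definitions written out and then used at its folded type.

-- Dividing an exact multiple q·k by k > 0 returns q: the quotient Q satisfies
-- Q·k ≤ q·k < (Q+1)·k, hence Q ≤ q < Q + 1.
÷-exact : ∀ q k → 0 < k → (q * + k) ÷ k ≡ q
÷-exact q (suc k) _ = ≤-antisym Q≤q q≤Q
  where
  Q : ℤ
  Q = (q * + suc k) /ℕ suc k
  Q≤q : Q ≤ℤ q
  Q≤q = *-cancelʳ-≤-pos Q q (+ suc k) ([n/ℕd]*d≤n (q * + suc k) (suc k))
  q<Q+1 : q <ℤ sucℤ Q
  q<Q+1 = *-cancelʳ-<-nonNeg (+ suc k) (n<s[n/ℕd]*d (q * + suc k) (suc k))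
  q≤Q : q ≤ℤ Q
  q≤Q = ≤-trans (i<j⇒i≤pred[j] q<Q+1) (≤-reflexive (pred-suc Q))

cancel-factor : ∀ d .{{_ : NonZero d}} u → d * u ≡ 0ℤ → u ≡ 0ℤ
cancel-factor d u du≡0 = *-cancelˡ-≡ d u 0ℤ (trans du≡0 (sym (*-zeroʳ d)))

W : ℤ → ℕ → ℤ
W d 0             = + 0
W d 1             = + 1
W d (suc (suc m)) = + 2 * (d * d - + 1) * W d (suc m) - W d m + + 2

-- U_m = 1 + (δ²-2)·W_m: the recurrence of U turns into that of W under this
-- substitution, because 2(δ²-1)·1 - 1 = 1 + (δ²-2)·2.
U≡1+[δ²-2]W : ∀ δ m → U δ m ≡ + 1 + (+ δ * + δ - + 2) * W (+ δ) m
U≡1+[δ²-2]W δ m = proj₁ (consecutive m)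
  where
  d : ℤ
  d = + δ
  shift : ℤ → ℤ
  shift w = + 1 + (d * d - + 2) * w
  base₀ : ∀ d → + 1 ≡ + 1 + (d * d - + 2) * + 0
  base₀ = solve-∀
  base₁ : ∀ d → d * d - + 1 ≡ + 1 + (d * d - + 2) * + 1
  base₁ = solve-∀
  recurrence : ∀ d x y → + 2 * (d * d - + 1) * (+ 1 + (d * d - + 2) * y) - (+ 1 + (d * d - + 2) * x)
                       ≡ + 1 + (d * d - + 2) * (+ 2 * (d * d - + 1) * y - x + + 2)
  recurrence = solve-∀
  consecutive : ∀ m → U δ m ≡ shift (W d m) × U δ (suc m) ≡ shift (W d (suc m))
  consecutive 0       = base₀ d , base₁ d
  consecutive (suc m) with consecutive m
  ... | Uₘ , Uₘ₊₁ = Uₘ₊₁ , (begin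
    + 2 * (d * d - + 1) * U δ (suc m) - U δ m
      ≡⟨ cong₂ (λ u v → + 2 * (d * d - + 1) * u - v) Uₘ₊₁ Uₘ ⟩
    + 2 * (d * d - + 1) * shift (W d (suc m)) - shift (W d m)
      ≡⟨ recurrence d (W d m) (W d (suc m)) ⟩
    shift (W d (suc (suc m))) ∎)

conic : ℤ → ℤ → ℤ → ℤ
conic d x y = x * x + y * y - + 2 * (d * d - + 1) * x * y - + 2 * x - + 2 * y + + 1

conic-sym : ∀ d x y → conic d x y ≡ conic d y x
conic-sym = identity
  where
  identity : ∀ d x y → x * x + y * y - + 2 * (d * d - + 1) * x * y - + 2 * x - + 2 * y + + 1
                     ≡ y * y + x * x - + 2 * (d * d - + 1) * y * x - + 2 * y - + 2 * x + + 1
  identity = solve-∀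

-- Vieta jumping: x and 2(d²-1)y - x + 2 are the two roots of conic(·, y) = 0,
-- so replacing the pair (x, y) by (y, 2(d²-1)y - x + 2) preserves the conic.
conic-jump : ∀ d x y → conic d y (+ 2 * (d * d - + 1) * y - x + + 2) ≡ conic d x y
conic-jump = identity
  where
  identity : ∀ d x y →
      y * y + (+ 2 * (d * d - + 1) * y - x + + 2) * (+ 2 * (d * d - + 1) * y - x + + 2)
      - + 2 * (d * d - + 1) * y * (+ 2 * (d * d - + 1) * y - x + + 2)
      - + 2 * y - + 2 * (+ 2 * (d * d - + 1) * y - x + + 2) + + 1
    ≡ x * x + y * y - + 2 * (d * d - + 1) * x * y - + 2 * x - + 2 * y + + 1
  identity = solve-∀

conic-W : ∀ d m → conic d (W d m) (W d (suc m)) ≡ 0ℤ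
conic-W d 0       = start d
  where
  start : ∀ d → + 0 * + 0 + + 1 * + 1 - + 2 * (d * d - + 1) * + 0 * + 1 - + 2 * + 0 - + 2 * + 1 + + 1 ≡ 0ℤ
  start = solve-∀
conic-W d (suc m) = trans (conic-jump d (W d m) (W d (suc m))) (conic-W d m)

-- Consecutive terms add up to 1 modulo d: W_m + W_{m+1} = 1 + d·z.  The step
-- uses W_{m+1} + W_{m+2} = 2d²·W_{m+1} + 2 - (W_m + W_{m+1}).
W-consecutive-sum : ∀ d m → ∃[ z ] (W d m + W d (suc m) ≡ + 1 + d * z)
W-consecutive-sum d 0       = + 0 , start d
  where
  start : ∀ d → + 0 + + 1 ≡ + 1 + d * + 0
  start = solve-∀
W-consecutive-sum d (suc m) with W-consecutive-sum d m
... | z , sum≡ = + 2 * d * y - z , (begin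
    y + (+ 2 * (d * d - + 1) * y - x + + 2)  ≡⟨ reflect d x y ⟩
    + 2 * d * d * y + + 2 - (x + y)         ≡⟨ cong (λ s → + 2 * d * d * y + + 2 - s) sum≡ ⟩
    + 2 * d * d * y + + 2 - (+ 1 + d * z)   ≡⟨ regroup d y z ⟩
    + 1 + d * (+ 2 * d * y - z)             ∎)
  where
  x y : ℤ
  x = W d m
  y = W d (suc m)
  reflect : ∀ d x y → y + (+ 2 * (d * d - + 1) * y - x + + 2) ≡ + 2 * d * d * y + + 2 - (x + y)
  reflect = solve-∀
  regroup : ∀ d y z → + 2 * d * d * y + + 2 - (+ 1 + d * z) ≡ + 1 + d * (+ 2 * d * y - z)
  regroup = solve-∀

-- f_m(t) with n_m = 2(d+1)x - 1 and (n_m² + 1)/2 = 2((d+1)x)² - 2(d+1)x + 1.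
quadratic : ℤ → ℤ → ℤ → ℤ
quadratic d x t = t * t - (d * (+ 2 * (d + + 1) * x - + 1) + d + + 2) * t
                + (+ 2 * ((d + + 1) * x) * ((d + + 1) * x) - + 2 * ((d + + 1) * x) + + 1)

quadratic-conic : ∀ d x z → d * d * quadratic d x (+ 1 + (d + + 1) * z)
                          ≡ (d + + 1) * (d + + 1) * conic d x (+ 1 + d * z - x)
quadratic-conic = identity
  where
  identity : ∀ d x z →
      d * d * ((+ 1 + (d + + 1) * z) * (+ 1 + (d + + 1) * z)
               - (d * (+ 2 * (d + + 1) * x - + 1) + d + + 2) * (+ 1 + (d + + 1) * z)
               + (+ 2 * ((d + + 1) * x) * ((d + + 1) * x) - + 2 * ((d + + 1) * x) + + 1))
    ≡ (d + + 1) * (d + + 1) * (x * x + (+ 1 + d * z - x) * (+ 1 + d * z - x)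
               - + 2 * (d * d - + 1) * x * (+ 1 + d * z - x) - + 2 * x - + 2 * (+ 1 + d * z - x) + + 1)
  identity = solve-∀

quadratic-root : ∀ d .{{_ : NonZero d}} x y z → conic d x y ≡ 0ℤ → x + y ≡ + 1 + d * z →
                 quadratic d x (+ 1 + (d + + 1) * z) ≡ 0ℤ
quadratic-root d x y z on-conic sum≡ =
  cancel-factor d _ (cancel-factor d (d * quadratic d x t) (begin
    d * (d * quadratic d x t)                 ≡⟨ sym (*-assoc d d _) ⟩
    d * d * quadratic d x t                   ≡⟨ quadratic-conic d x z ⟩
    c * conic d x (+ 1 + d * z - x)           ≡⟨ cong (λ v → c * conic d x v) y≡ ⟨
    c * conic d x y                           ≡⟨ cong (c *_) on-conic ⟩
    c * 0ℤ                                    ≡⟨ *-zeroʳ c ⟩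
    0ℤ                                        ∎))
  where
  t c : ℤ
  t = + 1 + (d + + 1) * z
  c = (d + + 1) * (d + + 1)
  y-isolated : ∀ x y → y ≡ x + y - x
  y-isolated = solve-∀
  y≡ : y ≡ + 1 + d * z - x
  y≡ = trans (y-isolated x y) (cong (_- x) sum≡)

D≡δ²-2 : ∀ δ → 2 ≤ δ ℕ.* δ → + D δ ≡ + δ * + δ - + 2
D≡δ²-2 δ 2≤δ² = begin
  + (δ ℕ.* δ ℕ.∸ 2)    ≡⟨ ⊖-≥ 2≤δ² ⟨
  (δ ℕ.* δ) ⊖ 2        ≡⟨ m-n≡m⊖n (δ ℕ.* δ) 2 ⟨
  + (δ ℕ.* δ) - + 2    ≡⟨ cong (_- + 2) (pos-* δ δ) ⟩
  + δ * + δ - + 2      ∎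

-- n_m = 2(δ+1)W_m - 1 for δ ≥ 2: the numerator of n_m is exactly
-- (2(δ+1)W_m - 1)·(δ² - 2).
nSeq≡ : ∀ δ → 2 ≤ δ → ∀ m → nSeq δ m ≡ + 2 * (+ δ + + 1) * W (+ δ) m - + 1
nSeq≡ δ 2≤δ m = begin
  (+ 2 * (d + + 1) * U δ m - d * (d + + 2)) ÷ D δ
    ≡⟨ cong (λ u → (+ 2 * (d + + 1) * u - d * (d + + 2)) ÷ D δ) (U≡1+[δ²-2]W δ m) ⟩
  (+ 2 * (d + + 1) * (+ 1 + (d * d - + 2) * w) - d * (d + + 2)) ÷ D δ
    ≡⟨ cong (_÷ D δ) (factor d w) ⟩
  ((+ 2 * (d + + 1) * w - + 1) * (d * d - + 2)) ÷ D δ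
    ≡⟨ cong (λ e → ((+ 2 * (d + + 1) * w - + 1) * e) ÷ D δ) (D≡δ²-2 δ 2≤δ²) ⟨
  ((+ 2 * (d + + 1) * w - + 1) * + D δ) ÷ D δ
    ≡⟨ ÷-exact _ (D δ) (ℕ.m<n⇒0<n∸m 2<δ²) ⟩
  + 2 * (d + + 1) * w - + 1 ∎
  where
  d w : ℤ
  d = + δ
  w = W d m
  4≤δ² : 4 ≤ δ ℕ.* δ
  4≤δ² = ℕ.*-mono-≤ 2≤δ 2≤δ
  2<δ² : 2 < δ ℕ.* δ
  2<δ² = ℕ.<-≤-trans (ℕ.s≤s (ℕ.s≤s (ℕ.s≤s ℕ.z≤n))) 4≤δ²
  2≤δ² : 2 ≤ δ ℕ.* δ
  2≤δ² = ℕ.<⇒≤ 2<δ²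
  factor : ∀ d w → + 2 * (d + + 1) * (+ 1 + (d * d - + 2) * w) - d * (d + + 2)
                 ≡ (+ 2 * (d + + 1) * w - + 1) * (d * d - + 2)
  factor = solve-∀

-- For δ ≥ 2, f_m is the quadratic attached to x = W_m: (n_m² + 1)/2 is an
-- exact halving of 2·(2((δ+1)x)² - 2(δ+1)x + 1).
f≡quadratic : ∀ δ → 2 ≤ δ → ∀ m t → f δ m t ≡ quadratic (+ δ) (W (+ δ) m) t
f≡quadratic δ 2≤δ m t rewrite nSeq≡ δ 2≤δ m =
  cong (λ c → t * t - (d * n + d + + 2) * t + c)
       (trans (cong (_÷ 2) (halve d x)) (÷-exact _ 2 (ℕ.s≤s ℕ.z≤n)))
  where
  d x n : ℤ
  d = + δ
  x = W d m
  n = + 2 * (d + + 1) * x - + 1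
  halve : ∀ d x → (+ 2 * (d + + 1) * x - + 1) * (+ 2 * (d + + 1) * x - + 1) + + 1
                ≡ (+ 2 * ((d + + 1) * x) * ((d + + 1) * x) - + 2 * ((d + + 1) * x) + + 1) * + 2
  halve = solve-∀

mainTheorem2 : (δ : ℕ) → 2 ∣ δ → 0 < δ → (m : ℕ) → 1 ≤ m →
    ∃[ t ] (f δ m t ≡ + 0 × f δ (suc m) t ≡ + 0)
mainTheorem2 δ 2∣δ 0<δ m _ with W-consecutive-sum (+ δ) m
... | z , sum≡ =
  t ,
  trans (f≡quadratic δ 2≤δ m t) (quadratic-root d x y z (conic-W d m) sum≡) ,
  trans (f≡quadratic δ 2≤δ (suc m) t)
        (quadratic-root d y x z (trans (conic-sym d y x) (conic-W d m)) (trans (+-comm y x) sum≡))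
  where
  instance
    δ≢0 : ℕ.NonZero δ
    δ≢0 = ℕ.>-nonZero 0<δ
  2≤δ : 2 ≤ δ
  2≤δ = ∣⇒≤ 2∣δ
  d x y t : ℤ
  d = + δ
  x = W d m
  y = W d (suc m)
  t = + 1 + (d + + 1) * z
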